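{- There exists a constant $\alpha>0$ such that for infinitely many $n$ there is a split graph $G$ on $n$ vertices with $\chi_{ssc}(G)\ge \alpha\sqrt{n}$; that is, there exist split graphs with $n$ vertices that require $\Omega(\sqrt{n})$ colours to be subset square coloured.
   Context: Graphs are finite, simple and undirected. For a vertex $v$, $N(v)$ is its open neighbourhood, $N[v]=N(v)\cup\{v\}$ and $\deg(v)=|N(v)|$. For a positive integer $q$, a $q$-subset square colouring of a graph $G$ is a function $c:V(G)\to\{c_0,c_1,\dots,c_q\}$ such that (i) for every vertex $v$ and every $i\in\{1,\dots,q\}$, $|c^{ -1}(c_i)\cap N[v]|\le 1$, and (ii) for every vertex $v$, $N[v]$ contains at most $\deg(v)$ vertices of colour $c_0$ (equivalently, $N[v]$ contains at least one vertex whose colour lies in $\{c_1,\dots,c_q\}$). $\chi_{ssc}(G)$ is the minimum $q$ such that $G$ admits a $q$-subset square colouring. A graph is a split graph if its vertex set can be partitioned into a clique and an independent set. -}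

module Defs where

open import Data.Nat using (ℕ; zero; suc; _+_; _*_; _≤_; _<_)
open import Data.Fin using (Fin; zero; suc)
open import Data.Bool using (Bool; true; false; _∧_; _∨_; not; if_then_else_)
open import Data.Product using (Σ; _×_; ∃; ∃-syntax)
open import Relation.Binary.PropositionalEquality using (_≡_; _≢_)
open import Relation.Nullary.Decidable using (⌊_⌋)
import Data.Fin as F

record Graph (n : ℕ) : Set where
  field
    adj   : Fin n → Fin n → Bool
    sym   : ∀ u v → adj u v ≡ adj v u
    irrefl : ∀ v → adj v v ≡ false
open Graph public

count : ∀ {n} → (Fin n → Bool) → ℕ
count {zero}  p = 0
count {suc n} p = (if p zero then 1 else 0) + count (λ i → p (suc i))

inClosedNbhd : ∀ {n} → Graph n → Fin n → Fin n → Bool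
inClosedNbhd G v u = ⌊ u F.≟ v ⌋ ∨ adj G v u

deg : ∀ {n} → Graph n → Fin n → ℕ
deg G v = count (adj G v)

-- split graph: V = K ∪ I with K a clique and I an independent set
-- (K given by its Boolean indicator; I is its complement)
IsSplit : ∀ {n} → Graph n → Set
IsSplit {n} G = Σ (Fin n → Bool) λ K →
  (∀ u v → K u ≡ true → K v ≡ true → u ≢ v → adj G u v ≡ true) ×
  (∀ u v → K u ≡ false → K v ≡ false → adj G u v ≡ false)

-- colours {c₀, c₁, …, c_q} are Fin (suc q); c₀ = zero, c_i = suc (i-1)
colourEq : ∀ {q} → Fin (suc q) → Fin (suc q) → Bool
colourEq a b = ⌊ a F.≟ b ⌋

IsSubsetSquareColouring : ∀ {n} → Graph n → (q : ℕ) → (Fin n → Fin (suc q)) → Set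
IsSubsetSquareColouring G q c =
  (∀ v (i : Fin q) →
     count (λ u → inClosedNbhd G v u ∧ colourEq (c u) (suc i)) ≤ 1) ×
  (∀ v → count (λ u → inClosedNbhd G v u ∧ colourEq (c u) zero) ≤ deg G v)

HasSSC : ∀ {n} → Graph n → ℕ → Set
HasSSC G q = Σ _ λ c → IsSubsetSquareColouring G q c

{-# OPTIONS --safe #-}
-- Take a clique K₁ … K_k and, for every ordered pair (x , y), an independent vertex adjacent
-- exactly to K_x and K_y; this split graph has n = k + k² vertices. In a subset square
-- colouring, pick a clique vertex K_x of colour c₀ if there is one. For each column y, N[K_x]
-- then contains a vertex of nonzero colour lying over y: K_y itself, or else the pair vertex
-- (x , y), whose closed neighbourhood {(x , y), K_x, K_y} must contain a nonzero colour.
-- Nonzero colours are distinct within N[K_x], so q ≥ k, i.e. n ≤ (2q)².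
module Submission where

open import Defs
open import Data.Nat using (ℕ; _*_; _≤_; _<_)
open import Data.Product using (Σ; _×_; ∃; ∃-syntax)

open import Data.Nat using (zero; suc; _+_; z≤n; s≤s; NonZero)
open import Data.Nat.Properties
  using (+-suc; ≤-trans; ≤-reflexive; <-irrefl; n≤1+n; m≤n+m; m≤m+n; m≤m*n;
         +-monoˡ-≤; *-mono-≤; *-monoˡ-≤; *-identityˡ; module ≤-Reasoning)
open import Data.Nat.Solver using (module +-*-Solver)
open import Data.Fin using (Fin; zero; suc; punchOut) renaming (_≟_ to _≟ᶠ_)
open import Data.Fin.Properties
  using (suc-injective; +↔⊎; *↔×; any?; punchOut-injective; injective⇒≤)
open import Data.Bool using (Bool; true; false; _∧_; _∨_; not)
open import Data.Product using (_,_; proj₁; proj₂)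
open import Data.Sum as Sum using (_⊎_; inj₁; inj₂)
open import Data.Sum.Function.Propositional using (_⊎-↔_)
open import Function using (_∘_; _↔_; Inverse)
open import Function.Definitions using (Injective)
open import Function.Construct.Identity using (↔-id)
open import Function.Construct.Composition using (_↔-∘_)
open import Relation.Nullary using (¬_; yes; no; contradiction)
open import Relation.Nullary.Decidable
  using (Dec; ⌊_⌋; isYes≗does; dec-true; dec-false; ⌊⌋-map′)
open import Relation.Binary.PropositionalEquality
  using (_≡_; _≢_; refl; cong; trans; cong₂; ≢-sym; module ≡-Reasoning) renaming (sym to ≡-sym)

count-cong : ∀ {n} {p r : Fin n → Bool} → (∀ u → p u ≡ r u) → count p ≡ count r
count-cong {zero}  p≗r = refl
count-cong {suc n} p≗r rewrite p≗r zero = cong (_ +_) (count-cong (p≗r ∘ suc))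

count-positive : ∀ {n} (p : Fin n → Bool) a → p a ≡ true → 1 ≤ count p
count-positive p zero    pa rewrite pa = s≤s z≤n
count-positive p (suc a) pa with p zero
... | true  = s≤s z≤n
... | false = count-positive (p ∘ suc) a pa

count≤1⇒unique : ∀ {n} (p : Fin n → Bool) a b → count p ≤ 1 → p a ≡ true → p b ≡ true → a ≡ b
count≤1⇒unique p zero    zero    _ _  _  = refl
count≤1⇒unique p zero    (suc b) c≤1 pa pb rewrite pa =
  contradiction (≤-trans (s≤s (count-positive (p ∘ suc) b pb)) c≤1) (<-irrefl refl)
count≤1⇒unique p (suc a) zero    c≤1 pa pb rewrite pb =
  contradiction (≤-trans (s≤s (count-positive (p ∘ suc) a pa)) c≤1) (<-irrefl refl)
count≤1⇒unique p (suc a) (suc b) c≤1 pa pb =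
  cong suc (count≤1⇒unique (p ∘ suc) a b (≤-trans (m≤n+m _ _) c≤1) pa pb)

⌊⌋-true : ∀ {p} {P : Set p} (P? : Dec P) → P → ⌊ P? ⌋ ≡ true
⌊⌋-true P? p = trans (isYes≗does P?) (dec-true P? p)

⌊⌋-false : ∀ {p} {P : Set p} (P? : Dec P) → ¬ P → ⌊ P? ⌋ ≡ false
⌊⌋-false P? ¬p = trans (isYes≗does P?) (dec-false P? ¬p)

count-insert : ∀ {n} (p : Fin n → Bool) v → p v ≡ false →
  count (λ u → ⌊ u ≟ᶠ v ⌋ ∨ p u) ≡ suc (count p)
count-insert p zero    pv rewrite pv = refl
count-insert p (suc v) pv = trans (cong (_ +_) shifted) (+-suc _ _)
  where
  shifted : count (λ u → ⌊ suc u ≟ᶠ suc v ⌋ ∨ p (suc u)) ≡ suc (count (p ∘ suc))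
  shifted = trans (count-cong λ u → cong (_∨ p (suc u)) (⌊⌋-map′ (cong suc) suc-injective (u ≟ᶠ v)))
                  (count-insert (p ∘ suc) v pv)

module _ {n} (G : Graph n) where

  inClosedNbhd-refl : ∀ v → inClosedNbhd G v v ≡ true
  inClosedNbhd-refl v rewrite ⌊⌋-true (v ≟ᶠ v) refl = refl

  adj⇒inClosedNbhd : ∀ {v u} → adj G v u ≡ true → inClosedNbhd G v u ≡ true
  adj⇒inClosedNbhd {v} {u} vu rewrite vu with u ≟ᶠ v
  ... | yes _ = refl
  ... | no  _ = refl

  inClosedNbhd⇒≡⊎adj : ∀ {v u} → inClosedNbhd G v u ≡ true → u ≡ v ⊎ adj G v u ≡ true
  inClosedNbhd⇒≡⊎adj {v} {u} u∈N[v] with u ≟ᶠ v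
  ... | yes u≡v = inj₁ u≡v
  ... | no  _   = inj₂ u∈N[v]

  count-closedNbhd : ∀ v → count (inClosedNbhd G v) ≡ suc (deg G v)
  count-closedNbhd v = count-insert (adj G v) v (irrefl G v)

module _ {n} (G : Graph n) {q} (c : Fin n → Fin (suc q)) (ssc : IsSubsetSquareColouring G q c) where

  nonzero-colour-unique : ∀ {v a b} → inClosedNbhd G v a ≡ true → inClosedNbhd G v b ≡ true →
                          c a ≡ c b → c a ≢ zero → a ≡ b
  nonzero-colour-unique {v} {a} {b} a∈N b∈N ca≡cb ca≢0 with c a in ca
  ... | zero  = contradiction refl ca≢0
  ... | suc i = count≤1⇒unique _ a b (proj₁ ssc v i) (marked a∈N ca) (marked b∈N (≡-sym ca≡cb))
    where
    marked : ∀ {x} → inClosedNbhd G v x ≡ true → c x ≡ suc i →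
             (inClosedNbhd G v x ∧ colourEq (c x) (suc i)) ≡ true
    marked x∈N cx rewrite x∈N | cx = ⌊⌋-true (suc i ≟ᶠ suc i) refl

  closedNbhd-has-nonzero : ∀ w → ¬ (∀ u → inClosedNbhd G w u ≡ true → c u ≡ zero)
  closedNbhd-has-nonzero w allZero =
    <-irrefl refl (≤-trans (≤-reflexive (≡-sym zeros≡N[w])) (proj₂ ssc w))
    where
    zero-on-N[w] : ∀ u → (inClosedNbhd G w u ∧ colourEq (c u) zero) ≡ inClosedNbhd G w u
    zero-on-N[w] u with inClosedNbhd G w u in u∈N
    ... | false = refl
    ... | true rewrite allZero u u∈N = refl
    zeros≡N[w] : count (λ u → inClosedNbhd G w u ∧ colourEq (c u) zero) ≡ suc (deg G w)
    zeros≡N[w] = trans (count-cong zero-on-N[w]) (count-closedNbhd G w)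

  nonzero-injection-≤ : ∀ {k} v (f : Fin k → Fin n) → Injective _≡_ _≡_ f →
                        (∀ y → inClosedNbhd G v (f y) ≡ true) → (∀ y → c (f y) ≢ zero) → k ≤ q
  nonzero-injection-≤ v f f-inj f∈N cf≢0 = injective⇒≤ colourIndex-injective
    where
    colourIndex : Fin _ → Fin q
    colourIndex y = punchOut (≢-sym (cf≢0 y))
    colourIndex-injective : Injective _≡_ _≡_ colourIndex
    colourIndex-injective {y} {y′} eq =
      f-inj (nonzero-colour-unique (f∈N y) (f∈N y′) same-colour (cf≢0 y))
      where
      same-colour : c (f y) ≡ c (f y′)
      same-colour = punchOut-injective (≢-sym (cf≢0 y)) (≢-sym (cf≢0 y′)) eq

module RelationGraph {n} {V : Set} (enc : Fin n ↔ V) (R : V → V → Bool)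
                     (R-sym : ∀ x y → R x y ≡ R y x) (R-irrefl : ∀ x → R x x ≡ false) where

  open Inverse enc public using (to; from; inverseʳ; strictlyInverseˡ; strictlyInverseʳ)

  graph : Graph n
  graph = record
    { adj    = λ u v → R (to u) (to v)
    ; sym    = λ u v → R-sym (to u) (to v)
    ; irrefl = λ v → R-irrefl (to v)
    }

  to≡⇒≡from : ∀ {u x} → to u ≡ x → u ≡ from x
  to≡⇒≡from tu≡x = ≡-sym (inverseʳ (≡-sym tu≡x))

  to-injective : ∀ {u v} → to u ≡ to v → u ≡ v
  to-injective {u} {v} tu≡tv = trans (to≡⇒≡from tu≡tv) (strictlyInverseʳ v)

  from-injective : ∀ {x y} → from x ≡ from y → x ≡ y
  from-injective {x} {y} fx≡fy =
    trans (≡-sym (strictlyInverseˡ x)) (trans (cong to fx≡fy) (strictlyInverseˡ y))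

  R⇒inClosedNbhd : ∀ x y → R x y ≡ true → inClosedNbhd graph (from x) (from y) ≡ true
  R⇒inClosedNbhd x y xy =
    adj⇒inClosedNbhd graph (trans (cong₂ R (strictlyInverseˡ x) (strictlyInverseˡ y)) xy)

  inClosedNbhd⇒≡⊎R : ∀ {x u} → inClosedNbhd graph (from x) u ≡ true → to u ≡ x ⊎ R x (to u) ≡ true
  inClosedNbhd⇒≡⊎R {x} {u} u∈N with inClosedNbhd⇒≡⊎adj graph u∈N
  ... | inj₁ refl = inj₁ (strictlyInverseˡ x)
  ... | inj₂ xu   = inj₂ (trans (cong (λ z → R z (to u)) (≡-sym (strictlyInverseˡ x))) xu)

module PairGraph (k : ℕ) where

  Vertex : Set
  Vertex = Fin k ⊎ (Fin k × Fin k)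

  incident : Fin k → Fin k × Fin k → Bool
  incident a (x , y) = ⌊ a ≟ᶠ x ⌋ ∨ ⌊ a ≟ᶠ y ⌋

  incident⇒≡⊎≡ : ∀ {a x y} → incident a (x , y) ≡ true → a ≡ x ⊎ a ≡ y
  incident⇒≡⊎≡ {a} {x} {y} a∈xy with a ≟ᶠ x | a ≟ᶠ y
  ... | yes a≡x | _       = inj₁ a≡x
  ... | no  _   | yes a≡y = inj₂ a≡y

  edge : Vertex → Vertex → Bool
  edge (inj₁ a) (inj₁ b) = not ⌊ a ≟ᶠ b ⌋
  edge (inj₁ a) (inj₂ p) = incident a p
  edge (inj₂ p) (inj₁ a) = incident a p
  edge (inj₂ _) (inj₂ _) = false

  edge-sym : ∀ v w → edge v w ≡ edge w v
  edge-sym (inj₁ a) (inj₁ b) with a ≟ᶠ b | b ≟ᶠ a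
  ... | yes _   | yes _   = refl
  ... | no  _   | no  _   = refl
  ... | yes a≡b | no  b≢a = contradiction (≡-sym a≡b) b≢a
  ... | no  a≢b | yes b≡a = contradiction (≡-sym b≡a) a≢b
  edge-sym (inj₁ a) (inj₂ p) = refl
  edge-sym (inj₂ p) (inj₁ a) = refl
  edge-sym (inj₂ _) (inj₂ _) = refl

  edge-irrefl : ∀ v → edge v v ≡ false
  edge-irrefl (inj₁ a) = cong not (⌊⌋-true (a ≟ᶠ a) refl)
  edge-irrefl (inj₂ _) = refl

  edge-pairVertex : ∀ {x y} v → edge (inj₂ (x , y)) v ≡ true → v ≡ inj₁ x ⊎ v ≡ inj₁ y
  edge-pairVertex {x} {y} (inj₁ a) e with incident⇒≡⊎≡ {a} {x} {y} e
  ... | inj₁ refl = inj₁ refl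
  ... | inj₂ refl = inj₂ refl

  vertex↔ : Fin (k + k * k) ↔ Vertex
  vertex↔ = (↔-id (Fin k) ⊎-↔ *↔×) ↔-∘ +↔⊎

  open RelationGraph vertex↔ edge edge-sym edge-irrefl public renaming (graph to pairGraph)

  isCliqueVertex : Vertex → Bool
  isCliqueVertex (inj₁ _) = true
  isCliqueVertex (inj₂ _) = false

  pairGraph-isSplit : IsSplit pairGraph
  pairGraph-isSplit = isCliqueVertex ∘ to , clique , independent
    where
    clique : ∀ u v → isCliqueVertex (to u) ≡ true → isCliqueVertex (to v) ≡ true → u ≢ v →
             adj pairGraph u v ≡ true
    clique u v _ _ u≢v with to u in tu | to v in tv
    ... | inj₁ a | inj₁ b =
      cong not (⌊⌋-false (a ≟ᶠ b) λ { refl → u≢v (to-injective (trans tu (≡-sym tv))) })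
    independent : ∀ u v → isCliqueVertex (to u) ≡ false → isCliqueVertex (to v) ≡ false →
                  adj pairGraph u v ≡ false
    independent u v _ _ with to u | to v
    ... | inj₂ _ | inj₂ _ = refl

  cliqueVertex : Fin k → Fin (k + k * k)
  cliqueVertex y = from (inj₁ y)

  pairVertex : Fin k → Fin k → Fin (k + k * k)
  pairVertex x y = from (inj₂ (x , y))

  cliqueVertex∈N[cliqueVertex] : ∀ x y →
    inClosedNbhd pairGraph (cliqueVertex x) (cliqueVertex y) ≡ true
  cliqueVertex∈N[cliqueVertex] x y with x ≟ᶠ y
  ... | yes refl = inClosedNbhd-refl pairGraph (cliqueVertex x)
  ... | no  x≢y  = R⇒inClosedNbhd (inj₁ x) (inj₁ y) (cong not (⌊⌋-false (x ≟ᶠ y) x≢y))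

  pairVertex∈N[cliqueVertex] : ∀ x y →
    inClosedNbhd pairGraph (cliqueVertex x) (pairVertex x y) ≡ true
  pairVertex∈N[cliqueVertex] x y =
    R⇒inClosedNbhd (inj₁ x) (inj₂ (x , y)) (cong (_∨ ⌊ x ≟ᶠ y ⌋) (⌊⌋-true (x ≟ᶠ x) refl))

  closedNbhd-pairVertex : ∀ {x y u} → inClosedNbhd pairGraph (pairVertex x y) u ≡ true →
                          u ≡ pairVertex x y ⊎ u ≡ cliqueVertex x ⊎ u ≡ cliqueVertex y
  closedNbhd-pairVertex {x} {y} u∈N with inClosedNbhd⇒≡⊎R {inj₂ (x , y)} u∈N
  ... | inj₁ tu≡p = inj₁ (to≡⇒≡from tu≡p)
  ... | inj₂ e    = inj₂ (Sum.map to≡⇒≡from to≡⇒≡from (edge-pairVertex _ e))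

  column : Vertex → Fin k
  column (inj₁ y)       = y
  column (inj₂ (_ , y)) = y

  module _ {q} (c : Fin (k + k * k) → Fin (suc q)) (ssc : IsSubsetSquareColouring pairGraph q c) where

    record NonzeroInColumn (x y : Fin k) : Set where
      field
        vertex    : Vertex
        in-column : column vertex ≡ y
        near-x    : inClosedNbhd pairGraph (cliqueVertex x) (from vertex) ≡ true
        nonzero   : c (from vertex) ≢ zero

    nonzeroInColumn : ∀ x y → (c (cliqueVertex y) ≡ zero → c (cliqueVertex x) ≡ zero) →
                      NonzeroInColumn x y
    nonzeroInColumn x y y₀⇒x₀ with c (cliqueVertex y) ≟ᶠ zero
    ... | no  cy≢0 = record { vertex = inj₁ y ; in-column = refl
                            ; near-x = cliqueVertex∈N[cliqueVertex] x y ; nonzero = cy≢0 }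
    ... | yes cy≡0 = record { vertex = inj₂ (x , y) ; in-column = refl
                            ; near-x = pairVertex∈N[cliqueVertex] x y ; nonzero = cp≢0 }
      where
      cp≢0 : c (pairVertex x y) ≢ zero
      cp≢0 cp≡0 = closedNbhd-has-nonzero pairGraph c ssc (pairVertex x y) zero-on-N[p]
        where
        zero-on-N[p] : ∀ u → inClosedNbhd pairGraph (pairVertex x y) u ≡ true → c u ≡ zero
        zero-on-N[p] u u∈N with closedNbhd-pairVertex {x} {y} u∈N
        ... | inj₁ refl        = cp≡0
        ... | inj₂ (inj₁ refl) = y₀⇒x₀ cy≡0
        ... | inj₂ (inj₂ refl) = cy≡0

    colours≥k-centredAt : ∀ x → (∀ y → c (cliqueVertex y) ≡ zero → c (cliqueVertex x) ≡ zero) → k ≤ q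
    colours≥k-centredAt x y₀⇒x₀ = nonzero-injection-≤ pairGraph c ssc (cliqueVertex x) transversal
      transversal-injective (λ y → near-x (choice y)) (λ y → nonzero (choice y))
      where
      open NonzeroInColumn
      open ≡-Reasoning
      choice : ∀ y → NonzeroInColumn x y
      choice y = nonzeroInColumn x y (y₀⇒x₀ y)
      transversal : Fin k → Fin (k + k * k)
      transversal y = from (vertex (choice y))
      transversal-injective : Injective _≡_ _≡_ transversal
      transversal-injective {y} {y′} eq = begin
        y                           ≡⟨ in-column (choice y) ⟨
        column (vertex (choice y))  ≡⟨ cong column (from-injective {vertex (choice y)} {vertex (choice y′)} eq) ⟩
        column (vertex (choice y′)) ≡⟨ in-column (choice y′) ⟩
        y′                          ∎

  pairGraph-colours≥k : ∀ {q} → Fin k → HasSSC pairGraph q → k ≤ q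
  pairGraph-colours≥k x₀ (c , ssc) with any? (λ x → c (cliqueVertex x) ≟ᶠ zero)
  ... | yes (x , cx≡0) = colours≥k-centredAt c ssc x (λ _ _ → cx≡0)
  ... | no  noZero     = colours≥k-centredAt c ssc x₀ (λ y cy≡0 → contradiction (y , cy≡0) noZero)

k+k*k≤[q*2]² : ∀ {k q} → .{{NonZero k}} → k ≤ q → k + k * k ≤ (q * 2) * (q * 2)
k+k*k≤[q*2]² {k} {q} k≤q = begin
  k + k * k                         ≤⟨ +-monoˡ-≤ (k * k) (m≤m*n k k) ⟩
  k * k + k * k                     ≤⟨ m≤m+n _ _ ⟩
  (k * k + k * k) + (k * k + k * k) ≡⟨ four-squares k ⟩
  (k * 2) * (k * 2)                 ≤⟨ *-mono-≤ 2k≤2q 2k≤2q ⟩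
  (q * 2) * (q * 2)                 ∎
  where
  open ≤-Reasoning
  open +-*-Solver
  four-squares : ∀ x → (x * x + x * x) + (x * x + x * x) ≡ (x * 2) * (x * 2)
  four-squares =
    solve 1 (λ x → (x :* x :+ x :* x) :+ (x :* x :+ x :* x) := (x :* con 2) :* (x :* con 2)) refl
  2k≤2q : k * 2 ≤ q * 2
  2k≤2q = *-monoˡ-≤ 2 k≤q

mainTheorem13 : ∃[ a ] ∃[ b ] (0 < a × 0 < b ×
    (∀ m → ∃[ n ] (m ≤ n × Σ (Graph n) λ G → IsSplit G ×
    (∀ q → 1 ≤ q → HasSSC G q → (a * a) * n ≤ (q * b) * (q * b)))))
mainTheorem13 = 1 , 2 , s≤s z≤n , s≤s z≤n , λ m →
  let open PairGraph (suc m) in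
  suc m + suc m * suc m , ≤-trans (n≤1+n m) (m≤m+n _ _) , pairGraph , pairGraph-isSplit ,
  λ q _ hasSSC →
    ≤-trans (≤-reflexive (*-identityˡ _)) (k+k*k≤[q*2]² (pairGraph-colours≥k zero hasSSC))
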